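{- Let $r \geq 1$ be an integer, and let $\{c^{(r)}_k\}_{k \geq 0}$ be the sequence of rational numbers determined by \[ \sum_{k=0}^{n}\binom{n}{k}^r\binom{n+k}{k}^r = \sum_{k=0}^{n}\binom{n}{k}\binom{n+k}{k}\,c^{(r)}_k \qquad \text{for all } n = 0,1,2,\dots \] Then $c^{(r)}_k \in \mathbb{Z}$ for every $k \geq 0$.
   Context: The defining identities determine the $c^{(r)}_k$ uniquely: the identity for $n$ involves only $c^{(r)}_0,\dots,c^{(r)}_n$, and $c^{(r)}_n$ appears in it with the nonzero coefficient $\binom{2n}{n}$, so the $c^{(r)}_k$ can be solved for successively. -}

module Defs where

open import Data.Nat using (ℕ; zero; suc)
import Data.Nat as ℕ
open import Data.Nat.Combinatorics using (_C_)
open import Data.Integer using (ℤ; +_)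
open import Data.Rational using (ℚ; 0ℚ; _+_; _*_; _/_)

sumℚ : ℕ → (ℕ → ℚ) → ℚ
sumℚ zero    f = f 0
sumℚ (suc n) f = sumℚ n f + f (suc n)

sumℕ : ℕ → (ℕ → ℕ) → ℕ
sumℕ zero    f = f 0
sumℕ (suc n) f = sumℕ n f ℕ.+ f (suc n)

ℕ→ℚ : ℕ → ℚ
ℕ→ℚ m = (+ m) / 1

ℤ→ℚ : ℤ → ℚ
ℤ→ℚ z = z / 1

lhs : ℕ → ℕ → ℕ
lhs r n = sumℕ n (λ k → ((n C k) ℕ.^ r) ℕ.* (((n ℕ.+ k) C k) ℕ.^ r))

rhs : (ℕ → ℚ) → ℕ → ℚ
rhs c n = sumℚ n (λ k → ℕ→ℚ ((n C k) ℕ.* ((n ℕ.+ k) C k)) * c k)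

Defining : ℕ → (ℕ → ℚ) → Set
Defining r c = ∀ (n : ℕ) → ℕ→ℚ (lhs r n) ≡ rhs c n
  where open import Relation.Binary.PropositionalEquality using (_≡_)

-- Write B k n = C(n,k) C(n+k,k), so that the identities read Σ_k B k n ^ r = Σ_k B k n · c_k.
-- From the recurrence (k+1)² B (k+1) n = (n-k)(n+k+1) B k n one gets, by induction on k,
--   B k n · B l n = Σ_{d ≤ l} C(k+l,k) C(k+d,l) C(l,d) · B (k+d) n,
-- a linearisation with coefficients in ℕ. Hence every power of B k, and so the left-hand side, is
-- Σ_m D m · B m n for some D : ℕ → ℕ. The defining identities are a triangular system in the c_k
-- whose diagonal B n n is nonzero, so c_k = D k.

module Submission where

open import Data.Nat using (ℕ; zero; suc; _+_; _*_; _∸_; _^_; _≤_; _<_; _≥_; z≤n; s≤s; z<s; s<s; _≤?_)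
open import Data.Nat.Properties
open import Data.Nat.Combinatorics using (_C_; nCn≡1; nC1≡n; k>n⇒nCk≡0; nCk+nC[k+1]≡[n+1]C[k+1])
open import Data.Nat.Induction using (<-rec)
open import Data.Nat.Tactic.RingSolver using (solve-∀)
open import Data.Integer using (ℤ)
import Data.Integer as ℤ
import Data.Integer.Properties as ℤ
import Data.Integer.Tactic.RingSolver as ℤ
open import Data.Rational using (ℚ; toℚᵘ; fromℚᵘ)
import Data.Rational as ℚ
import Data.Rational.Properties as ℚ
import Data.Rational.Unnormalised as ℚᵘ
import Data.Rational.Unnormalised.Properties as ℚᵘ
open import Data.Product using (∃; _×_; _,_)
open import Data.List using (List; []; _∷_; _++_; map; downFrom)
open import Function using (_∘_)
open import Relation.Binary.PropositionalEquality
open import Relation.Nullary using (yes; no; contradiction)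
open import Algebra.Properties.CommutativeSemigroup +-commutativeSemigroup
  using () renaming (interchange to +-interchange)
open import Algebra.Properties.CommutativeSemigroup *-commutativeSemigroup
  using () renaming (interchange to *-interchange; x∙yz≈y∙xz to x*[y*z]≡y*[x*z])
open import Algebra.Properties.Group ℚ.+-0-group using (∙-cancelˡ)
open import Defs

open ≡-Reasoning

sumℕ-cong : ∀ l {f g : ℕ → ℕ} → (∀ d → f d ≡ g d) → sumℕ l f ≡ sumℕ l g
sumℕ-cong zero    f≗g = f≗g 0
sumℕ-cong (suc l) f≗g = cong₂ _+_ (sumℕ-cong l f≗g) (f≗g (suc l))

sumℕ-distrib-+ : ∀ l (f g : ℕ → ℕ) → sumℕ l (λ d → f d + g d) ≡ sumℕ l f + sumℕ l g
sumℕ-distrib-+ zero    f g = refl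
sumℕ-distrib-+ (suc l) f g rewrite sumℕ-distrib-+ l f g =
  +-interchange (sumℕ l f) (sumℕ l g) (f (suc l)) (g (suc l))

*-distribˡ-sumℕ : ∀ l c (f : ℕ → ℕ) → c * sumℕ l f ≡ sumℕ l (λ d → c * f d)
*-distribˡ-sumℕ zero    c f = refl
*-distribˡ-sumℕ (suc l) c f rewrite sym (*-distribˡ-sumℕ l c f) = *-distribˡ-+ c _ _

sumℕ-vanishes : ∀ l (f : ℕ → ℕ) → (∀ d → d ≤ l → f d ≡ 0) → sumℕ l f ≡ 0
sumℕ-vanishes zero    f f≡0 = f≡0 0 z≤n
sumℕ-vanishes (suc l) f f≡0
  rewrite sumℕ-vanishes l f (λ d d≤l → f≡0 d (m≤n⇒m≤1+n d≤l)) = f≡0 (suc l) ≤-refl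

sumℕ-extend : ∀ n K (f : ℕ → ℕ) → n ≤ K → (∀ d → n < d → f d ≡ 0) → sumℕ n f ≡ sumℕ K f
sumℕ-extend n zero    f z≤n f≡0 = refl
sumℕ-extend n (suc K) f n≤1+K f≡0 with n ≤? K
... | yes n≤K rewrite f≡0 (suc K) (s≤s n≤K) = trans (sumℕ-extend n K f n≤K f≡0) (sym (+-identityʳ _))
... | no  n≰K rewrite ≤-antisym n≤1+K (≰⇒> n≰K) = refl

sumℕ-last : ∀ l (f : ℕ → ℕ) → (∀ d → d < l → f d ≡ 0) → sumℕ l f ≡ f l
sumℕ-last zero    f f≡0 = refl
sumℕ-last (suc l) f f≡0 rewrite sumℕ-vanishes l f (λ d d≤l → f≡0 d (s≤s d≤l)) = refl

sumℕ-shift : ∀ l (f : ℕ → ℕ) → f 0 ≡ 0 → f (suc l) ≡ 0 → sumℕ l f ≡ sumℕ l (λ d → f (suc d))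
sumℕ-shift l f f0≡0 f[1+l]≡0 = +-cancelʳ-≡ (f (suc l)) _ _ (begin
  sumℕ l f + f (suc l)                     ≡⟨ split l ⟩
  f 0 + sumℕ l (λ d → f (suc d))           ≡⟨ cong₂ _+_ f0≡0 refl ⟩
  sumℕ l (λ d → f (suc d))                 ≡⟨ +-identityʳ _ ⟨
  sumℕ l (λ d → f (suc d)) + 0             ≡⟨ cong (sumℕ l (λ d → f (suc d)) +_) f[1+l]≡0 ⟨
  sumℕ l (λ d → f (suc d)) + f (suc l)     ∎)
  where
  split : ∀ l → sumℕ (suc l) f ≡ f 0 + sumℕ l (λ d → f (suc d))
  split zero    = refl
  split (suc l) rewrite split l = +-assoc (f 0) _ _

pointMass : ℕ → ℕ → ℕ → ℕ
pointMass zero    c zero    = c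
pointMass zero    c (suc m) = 0
pointMass (suc i) c zero    = 0
pointMass (suc i) c (suc m) = pointMass i c m

pointMass-at : ∀ i c → pointMass i c i ≡ c
pointMass-at zero    c = refl
pointMass-at (suc i) c = pointMass-at i c

pointMass-off : ∀ {i m} c → i ≢ m → pointMass i c m ≡ 0
pointMass-off {zero}  {zero}  c i≢m = contradiction refl i≢m
pointMass-off {zero}  {suc m} c i≢m = refl
pointMass-off {suc i} {zero}  c i≢m = refl
pointMass-off {suc i} {suc m} c i≢m = pointMass-off c (i≢m ∘ cong suc)

sumℕ-pointMass : ∀ n i c (g : ℕ → ℕ) → i ≤ n → sumℕ n (λ m → pointMass i c m * g m) ≡ c * g i
sumℕ-pointMass n i c g i≤n = begin
  sumℕ n h  ≡⟨ sumℕ-extend i n h i≤n (λ m i<m → cong (_* g m) (pointMass-off c (<⇒≢ i<m))) ⟨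
  sumℕ i h  ≡⟨ sumℕ-last i h (λ m m<i → cong (_* g m) (pointMass-off c (>⇒≢ m<i))) ⟩
  h i       ≡⟨ cong (_* g i) (pointMass-at i c) ⟩
  c * g i   ∎
  where
  h : ℕ → ℕ
  h m = pointMass i c m * g m

pascal : ∀ n k → suc n C suc k ≡ n C k + n C suc k
pascal n k = sym (nCk+nC[k+1]≡[n+1]C[k+1] n k)

0<nCk : ∀ {n k} → k ≤ n → 0 < n C k
0<nCk {n}     {zero}  _         = z<s
0<nCk {suc n} {suc k} (s≤s k≤n) rewrite pascal n k = <-≤-trans (0<nCk k≤n) (m≤m+n _ _)

[1+k]*[1+n]C[1+k]≡[1+n]*nCk : ∀ n k → suc k * (suc n C suc k) ≡ suc n * (n C k)
[1+k]*[1+n]C[1+k]≡[1+n]*nCk zero    zero    = refl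
[1+k]*[1+n]C[1+k]≡[1+n]*nCk zero    (suc k)
  rewrite k>n⇒nCk≡0 {1} {2 + k} (s<s z<s) | k>n⇒nCk≡0 {0} {1 + k} z<s = *-zeroʳ (2 + k)
[1+k]*[1+n]C[1+k]≡[1+n]*nCk (suc n) zero    =
  trans (+-identityʳ _) (trans (nC1≡n (2 + n)) (sym (*-identityʳ (2 + n))))
[1+k]*[1+n]C[1+k]≡[1+n]*nCk (suc n) (suc k) = begin
  (2 + k) * ((2 + n) C (2 + k))                     ≡⟨ cong ((2 + k) *_) (pascal (suc n) (suc k)) ⟩
  (2 + k) * (X + (1 + n) C (2 + k))                 ≡⟨ *-distribˡ-+ (2 + k) X ((1 + n) C (2 + k)) ⟩
  X + (1 + k) * X + (2 + k) * ((1 + n) C (2 + k))   ≡⟨ cong₂ (λ y z → X + y + z)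
                                                         ([1+k]*[1+n]C[1+k]≡[1+n]*nCk n k)
                                                         ([1+k]*[1+n]C[1+k]≡[1+n]*nCk n (suc k)) ⟩
  X + (1 + n) * (n C k) + (1 + n) * (n C (1 + k))   ≡⟨ +-assoc X ((1 + n) * (n C k)) ((1 + n) * (n C (1 + k))) ⟩
  X + ((1 + n) * (n C k) + (1 + n) * (n C (1 + k))) ≡⟨ cong (X +_) (*-distribˡ-+ (1 + n) (n C k) (n C (1 + k))) ⟨
  X + (1 + n) * (n C k + n C (1 + k))               ≡⟨ cong (λ y → X + (1 + n) * y) (pascal n k) ⟨
  (2 + n) * X                                       ∎
  where X = suc n C suc k

[1+m]*[m+t]C[1+m]≡t*[m+t]Cm : ∀ m t → suc m * ((m + t) C suc m) ≡ t * ((m + t) C m)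
[1+m]*[m+t]C[1+m]≡t*[m+t]Cm m t = +-cancelˡ-≡ (suc m * Y) _ _ (begin
  suc m * Y + suc m * X          ≡⟨ *-distribˡ-+ (suc m) Y X ⟨
  suc m * (Y + X)                ≡⟨ cong (suc m *_) (pascal (m + t) m) ⟨
  suc m * (suc (m + t) C suc m)  ≡⟨ [1+k]*[1+n]C[1+k]≡[1+n]*nCk (m + t) m ⟩
  (suc m + t) * Y                ≡⟨ *-distribʳ-+ Y (suc m) t ⟩
  suc m * Y + t * Y              ∎)
  where
  X = (m + t) C suc m
  Y = (m + t) C m

[1+n]*[1+n]Ck≡[1+n]*nCk+k*[1+n]Ck : ∀ n k → suc n * (suc n C k) ≡ suc n * (n C k) + k * (suc n C k)
[1+n]*[1+n]Ck≡[1+n]*nCk+k*[1+n]Ck n zero    = sym (+-identityʳ (suc n * 1))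
[1+n]*[1+n]Ck≡[1+n]*nCk+k*[1+n]Ck n (suc k) = begin
  suc n * (suc n C suc k)                       ≡⟨ cong (suc n *_) (pascal n k) ⟩
  suc n * (n C k + n C suc k)                   ≡⟨ *-distribˡ-+ (suc n) (n C k) (n C suc k) ⟩
  suc n * (n C k) + suc n * (n C suc k)         ≡⟨ +-comm (suc n * (n C k)) (suc n * (n C suc k)) ⟩
  suc n * (n C suc k) + suc n * (n C k)         ≡⟨ cong (suc n * (n C suc k) +_)
                                                        ([1+k]*[1+n]C[1+k]≡[1+n]*nCk n k) ⟨
  suc n * (n C suc k) + suc k * (suc n C suc k) ∎

B : ℕ → ℕ → ℕ
B k n = (n C k) * ((n + k) C k)

B-vanishes : ∀ {k n} → n < k → B k n ≡ 0
B-vanishes n<k rewrite k>n⇒nCk≡0 n<k = refl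

0<B[n,n] : ∀ n → 0 < B n n
0<B[n,n] n = *-mono-< (0<nCk (≤-refl {n})) (0<nCk (m≤n+m n n))

B-succ : ∀ k n → suc k * suc k * B (suc k) n ≡ (n ∸ k) * (n + suc k) * B k n
B-succ k n with k ≤? n
... | no k≰n rewrite B-vanishes (m<n⇒m<1+n (≰⇒> k≰n)) | m≤n⇒m∸n≡0 (<⇒≤ (≰⇒> k≰n)) = *-zeroʳ (suc k * suc k)
... | yes k≤n with m≤n⇒∃[o]m+o≡n k≤n
...   | t , refl = begin
  suc k * suc k * (((k + t) C suc k) * ((k + t + suc k) C suc k))
    ≡⟨ *-interchange (suc k) (suc k) ((k + t) C suc k) ((k + t + suc k) C suc k) ⟩
  (suc k * ((k + t) C suc k)) * (suc k * ((k + t + suc k) C suc k))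
    ≡⟨ cong₂ _*_ ([1+m]*[m+t]C[1+m]≡t*[m+t]Cm k t) second ⟩
  (t * ((k + t) C k)) * (suc (k + t + k) * ((k + t + k) C k))
    ≡⟨ regroup t ((k + t) C k) (k + t + k) ((k + t + k) C k) ⟩
  t * suc (k + t + k) * B k (k + t)
    ≡⟨ cong (λ j → t * j * B k (k + t)) (+-suc (k + t) k) ⟨
  t * (k + t + suc k) * B k (k + t)
    ≡⟨ cong (λ j → j * (k + t + suc k) * B k (k + t)) (m+n∸m≡n k t) ⟨
  (k + t ∸ k) * (k + t + suc k) * B k (k + t) ∎
  where
  second : suc k * ((k + t + suc k) C suc k) ≡ suc (k + t + k) * ((k + t + k) C k)
  second rewrite +-suc (k + t) k = [1+k]*[1+n]C[1+k]≡[1+n]*nCk (k + t + k) k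
  regroup : ∀ t x s y → (t * x) * (suc s * y) ≡ t * suc s * (x * y)
  regroup = solve-∀

[n∸k]*[n+1+k]-split : ∀ {k d n} → k + d ≤ n →
  (n ∸ k) * (n + suc k) ≡ (n ∸ (k + d)) * (n + suc (k + d)) + d * (k + k + suc d)
[n∸k]*[n+1+k]-split {k} {d} k+d≤n with m≤n⇒∃[o]m+o≡n k+d≤n
... | t , refl rewrite m+n∸m≡n (k + d) t | +-assoc k d t | m+n∸m≡n k (d + t) = polynomial k d t
  where
  polynomial : ∀ k d t →
    (d + t) * (k + (d + t) + suc k) ≡ t * (k + (d + t) + suc (k + d)) + d * (k + k + suc d)
  polynomial = solve-∀

B-shift : ∀ k d n → (n ∸ k) * (n + suc k) * B (k + d) n
        ≡ suc (k + d) * suc (k + d) * B (suc (k + d)) n + d * (k + k + suc d) * B (k + d) n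
B-shift k d n with k + d ≤? n
... | no k+d≰n
  rewrite B-vanishes (≰⇒> k+d≰n) | B-vanishes (m<n⇒m<1+n (≰⇒> k+d≰n))
        | *-zeroʳ ((n ∸ k) * (n + suc k)) | *-zeroʳ (suc (k + d) * suc (k + d))
        | *-zeroʳ (d * (k + k + suc d)) = refl
... | yes k+d≤n = begin
  (n ∸ k) * (n + suc k) * b
    ≡⟨ cong (_* b) ([n∸k]*[n+1+k]-split {k} {d} k+d≤n) ⟩
  ((n ∸ (k + d)) * (n + suc (k + d)) + d * (k + k + suc d)) * b
    ≡⟨ *-distribʳ-+ b ((n ∸ (k + d)) * (n + suc (k + d))) (d * (k + k + suc d)) ⟩
  (n ∸ (k + d)) * (n + suc (k + d)) * b + d * (k + k + suc d) * b
    ≡⟨ cong (_+ d * (k + k + suc d) * b) (B-succ (k + d) n) ⟨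
  suc (k + d) * suc (k + d) * B (suc (k + d)) n + d * (k + k + suc d) * b ∎
  where b = B (k + d) n

A : ℕ → ℕ → ℕ → ℕ
A k l d = ((k + l) C k) * ((k + d) C l) * (l C d)

A-vanishes : ∀ k {l d} → l < d → A k l d ≡ 0
A-vanishes k {l} {d} l<d rewrite k>n⇒nCk≡0 l<d = *-zeroʳ (((k + l) C k) * ((k + d) C l))

A-succ : ∀ k l d → suc k * suc k * A (suc k) l d
       ≡ suc (k + d) * suc (k + d) * A k l d + suc d * (k + k + suc (suc d)) * A k l (suc d)
A-succ k l d with d ≤? l
... | no d≰l
  rewrite A-vanishes (suc k) (≰⇒> d≰l) | A-vanishes k (≰⇒> d≰l) | A-vanishes k (m<n⇒m<1+n (≰⇒> d≰l))
        | *-zeroʳ (suc k * suc k) | *-zeroʳ (suc (k + d) * suc (k + d))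
        | *-zeroʳ (suc d * (k + k + suc (suc d))) = refl
... | yes d≤l with m≤n⇒∃[o]m+o≡n d≤l
...   | e , refl rewrite +-suc k d =
  +-cancelʳ-≡ extra _ _ (begin
    suc k * suc k * (P * Q * s) + extra
      ≡⟨ cong (_+ extra) (regroup₁ k P Q s) ⟩
    (suc k * P) * suc k * Q * s + extra
      ≡⟨ cong (λ x → x * suc k * Q * s + extra) ([1+k]*[1+n]C[1+k]≡[1+n]*nCk (k + l) k) ⟩
    suc (k + l) * p * suc k * Q * s + extra
      ≡⟨ regroup₂ k d e p Q s ⟩
    suc (k + d) * p * s * (suc (k + d) * Q) + (k + k + suc (suc d)) * p * Q * (e * s)
      ≡⟨ cong₂ (λ x y → suc (k + d) * p * s * x + (k + k + suc (suc d)) * p * Q * y)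
               ([1+n]*[1+n]Ck≡[1+n]*nCk+k*[1+n]Ck (k + d) l) (sym ([1+m]*[m+t]C[1+m]≡t*[m+t]Cm d e)) ⟩
    suc (k + d) * p * s * (suc (k + d) * q + l * Q) + (k + k + suc (suc d)) * p * Q * (suc d * s')
      ≡⟨ regroup₃ k d e p q Q s s' ⟩
    suc (k + d) * suc (k + d) * (p * q * s) + suc d * (k + k + suc (suc d)) * (p * Q * s') + extra ∎)
  where
  p = (k + l) C k
  P = suc (k + l) C suc k
  q = (k + d) C l
  Q = suc (k + d) C l
  s = l C d
  s' = l C suc d
  -- added to both sides so that no subtraction occurs
  extra = suc (k + d) * l * (p * Q * s)
  regroup₁ : ∀ k P Q s → suc k * suc k * (P * Q * s) ≡ (suc k * P) * suc k * Q * s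
  regroup₁ = solve-∀
  regroup₂ : ∀ k d e p Q s →
    suc (k + (d + e)) * p * suc k * Q * s + suc (k + d) * (d + e) * (p * Q * s)
      ≡ suc (k + d) * p * s * (suc (k + d) * Q) + (k + k + suc (suc d)) * p * Q * (e * s)
  regroup₂ = solve-∀
  regroup₃ : ∀ k d e p q Q s s' →
    suc (k + d) * p * s * (suc (k + d) * q + (d + e) * Q) + (k + k + suc (suc d)) * p * Q * (suc d * s')
      ≡ suc (k + d) * suc (k + d) * (p * q * s) + suc d * (k + k + suc (suc d)) * (p * Q * s')
        + suc (k + d) * (d + e) * (p * Q * s)
  regroup₃ = solve-∀

A-succ-scaled : ∀ k l d x →
  A k l d * (suc (k + d) * suc (k + d) * x) + A k l (suc d) * (suc d * (k + k + suc (suc d)) * x)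
    ≡ suc k * suc k * (A (suc k) l d * x)
A-succ-scaled k l d x = begin
  A k l d * (α * x) + A k l (suc d) * (β * x)   ≡⟨ regroup (A k l d) α (A k l (suc d)) β x ⟩
  (α * A k l d + β * A k l (suc d)) * x         ≡⟨ cong (_* x) (A-succ k l d) ⟨
  suc k * suc k * A (suc k) l d * x             ≡⟨ *-assoc (suc k * suc k) (A (suc k) l d) x ⟩
  suc k * suc k * (A (suc k) l d * x)           ∎
  where
  α = suc (k + d) * suc (k + d)
  β = suc d * (k + k + suc (suc d))
  regroup : ∀ y a z c x → y * (a * x) + z * (c * x) ≡ (a * y + c * z) * x
  regroup = solve-∀

B-product : ∀ k l n → B k n * B l n ≡ sumℕ l (λ d → A k l d * B (k + d) n)
B-product zero    l n = sym (trans (sumℕ-last l _ below) diagonal)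
  where
  below : ∀ d → d < l → A 0 l d * B d n ≡ 0
  below d d<l rewrite k>n⇒nCk≡0 d<l = refl
  diagonal : A 0 l l * B l n ≡ B 0 n * B l n
  diagonal rewrite nCn≡1 l = refl
B-product (suc k) l n = *-cancelˡ-≡ _ _ (suc k * suc k) (begin
  suc k * suc k * (B (suc k) n * B l n)
    ≡⟨ *-assoc (suc k * suc k) (B (suc k) n) (B l n) ⟨
  suc k * suc k * B (suc k) n * B l n
    ≡⟨ cong (_* B l n) (B-succ k n) ⟩
  w * B k n * B l n
    ≡⟨ *-assoc w (B k n) (B l n) ⟩
  w * (B k n * B l n)
    ≡⟨ cong (w *_) (B-product k l n) ⟩
  w * sumℕ l (λ d → A k l d * B (k + d) n)
    ≡⟨ *-distribˡ-sumℕ l w _ ⟩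
  sumℕ l (λ d → w * (A k l d * B (k + d) n))
    ≡⟨ sumℕ-cong l split ⟩
  sumℕ l (λ d → raised d + kept d)
    ≡⟨ sumℕ-distrib-+ l raised kept ⟩
  sumℕ l raised + sumℕ l kept
    ≡⟨ cong (sumℕ l raised +_) (sumℕ-shift l kept (*-zeroʳ (A k l 0)) kept[1+l]≡0) ⟩
  sumℕ l raised + sumℕ l (λ d → kept (suc d))
    ≡⟨ sumℕ-distrib-+ l raised (λ d → kept (suc d)) ⟨
  sumℕ l (λ d → raised d + kept (suc d))
    ≡⟨ sumℕ-cong l recombine ⟩
  sumℕ l (λ d → suc k * suc k * (A (suc k) l d * B (suc k + d) n))
    ≡⟨ *-distribˡ-sumℕ l (suc k * suc k) _ ⟨
  suc k * suc k * sumℕ l (λ d → A (suc k) l d * B (suc k + d) n) ∎)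
  where
  w = (n ∸ k) * (n + suc k)
  raised kept : ℕ → ℕ
  raised d = A k l d * (suc (k + d) * suc (k + d) * B (suc (k + d)) n)
  kept   d = A k l d * (d * (k + k + suc d) * B (k + d) n)

  split : ∀ d → w * (A k l d * B (k + d) n) ≡ raised d + kept d
  split d = trans (x*[y*z]≡y*[x*z] w (A k l d) (B (k + d) n))
                  (trans (cong (A k l d *_) (B-shift k d n)) (*-distribˡ-+ (A k l d) _ _))

  kept[1+l]≡0 : kept (suc l) ≡ 0
  kept[1+l]≡0 = cong (_* (suc l * (k + k + suc (suc l)) * B (k + suc l) n)) (A-vanishes k (n<1+n l))

  recombine : ∀ d → raised d + kept (suc d) ≡ suc k * suc k * (A (suc k) l d * B (suc k + d) n)
  recombine d = trans
    (cong (λ j → raised d + A k l (suc d) * (suc d * (k + k + suc (suc d)) * B j n)) (+-suc k d))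
    (A-succ-scaled k l d (B (suc (k + d)) n))

*-^-distrib : ∀ x y r → (x * y) ^ r ≡ x ^ r * y ^ r
*-^-distrib x y zero    = refl
*-^-distrib x y (suc r) rewrite *-^-distrib x y r = *-interchange x y (x ^ r) (y ^ r)

module Linearisation
  (b : ℕ → ℕ → ℕ)
  (b-vanishes : ∀ {m n} → n < m → b m n ≡ 0)
  (a : ℕ → ℕ → ℕ → ℕ)
  (b-product : ∀ k l n → b k n * b l n ≡ sumℕ l (λ d → a k l d * b (k + d) n))
  where

  Combination : Set
  Combination = List (ℕ × ℕ)

  ⟦_⟧ : Combination → ℕ → ℕ
  ⟦ []           ⟧ n = 0
  ⟦ (c , i) ∷ xs ⟧ n = c * b i n + ⟦ xs ⟧ n

  ⟦++⟧ : ∀ xs ys n → ⟦ xs ++ ys ⟧ n ≡ ⟦ xs ⟧ n + ⟦ ys ⟧ n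
  ⟦++⟧ []             ys n = refl
  ⟦++⟧ ((c , i) ∷ xs) ys n rewrite ⟦++⟧ xs ys n = sym (+-assoc (c * b i n) (⟦ xs ⟧ n) (⟦ ys ⟧ n))

  ⟦map-downFrom⟧ : ∀ l (coeff index : ℕ → ℕ) n →
    ⟦ map (λ d → coeff d , index d) (downFrom (suc l)) ⟧ n ≡ sumℕ l (λ d → coeff d * b (index d) n)
  ⟦map-downFrom⟧ zero    coeff index n = +-identityʳ (coeff 0 * b (index 0) n)
  ⟦map-downFrom⟧ (suc l) coeff index n rewrite ⟦map-downFrom⟧ l coeff index n =
    +-comm (coeff (suc l) * b (index (suc l)) n) _

  b-times : ℕ → Combination → Combination
  b-times k []             = []
  b-times k ((c , i) ∷ xs) = map (λ d → c * a k i d , k + d) (downFrom (suc i)) ++ b-times k xs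

  ⟦b-times⟧ : ∀ k xs n → ⟦ b-times k xs ⟧ n ≡ b k n * ⟦ xs ⟧ n
  ⟦b-times⟧ k []             n = sym (*-zeroʳ (b k n))
  ⟦b-times⟧ k ((c , i) ∷ xs) n = begin
    ⟦ map (λ d → c * a k i d , k + d) (downFrom (suc i)) ++ b-times k xs ⟧ n
      ≡⟨ ⟦++⟧ (map _ (downFrom (suc i))) (b-times k xs) n ⟩
    ⟦ map (λ d → c * a k i d , k + d) (downFrom (suc i)) ⟧ n + ⟦ b-times k xs ⟧ n
      ≡⟨ cong₂ _+_ (⟦map-downFrom⟧ i (λ d → c * a k i d) (k +_) n) (⟦b-times⟧ k xs n) ⟩
    sumℕ i (λ d → c * a k i d * b (k + d) n) + b k n * ⟦ xs ⟧ n
      ≡⟨ cong (_+ b k n * ⟦ xs ⟧ n) (sumℕ-cong i (λ d → *-assoc c (a k i d) (b (k + d) n))) ⟩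
    sumℕ i (λ d → c * (a k i d * b (k + d) n)) + b k n * ⟦ xs ⟧ n
      ≡⟨ cong (_+ b k n * ⟦ xs ⟧ n) (*-distribˡ-sumℕ i c _) ⟨
    c * sumℕ i (λ d → a k i d * b (k + d) n) + b k n * ⟦ xs ⟧ n
      ≡⟨ cong (λ z → c * z + b k n * ⟦ xs ⟧ n) (b-product k i n) ⟨
    c * (b k n * b i n) + b k n * ⟦ xs ⟧ n
      ≡⟨ cong (_+ b k n * ⟦ xs ⟧ n) (x*[y*z]≡y*[x*z] c (b k n) (b i n)) ⟩
    b k n * (c * b i n) + b k n * ⟦ xs ⟧ n
      ≡⟨ *-distribˡ-+ (b k n) (c * b i n) (⟦ xs ⟧ n) ⟨
    b k n * (c * b i n + ⟦ xs ⟧ n) ∎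

  b-power : ℕ → ℕ → Combination
  b-power k zero    = (1 , k) ∷ []
  b-power k (suc r) = b-times k (b-power k r)

  ⟦b-power⟧ : ∀ k r n → ⟦ b-power k r ⟧ n ≡ b k n ^ suc r
  ⟦b-power⟧ k zero    n = trans (+-identityʳ (1 * b k n)) (trans (*-identityˡ (b k n)) (sym (*-identityʳ (b k n))))
  ⟦b-power⟧ k (suc r) n rewrite ⟦b-times⟧ k (b-power k r) n | ⟦b-power⟧ k r n = refl

  powerSum : ℕ → ℕ → Combination
  powerSum zero    r = b-power 0 r
  powerSum (suc K) r = powerSum K r ++ b-power (suc K) r

  ⟦powerSum⟧ : ∀ K r n → ⟦ powerSum K r ⟧ n ≡ sumℕ K (λ k → b k n ^ suc r)
  ⟦powerSum⟧ zero    r n = ⟦b-power⟧ 0 r n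
  ⟦powerSum⟧ (suc K) r n
    rewrite ⟦++⟧ (powerSum K r) (b-power (suc K) r) n | ⟦powerSum⟧ K r n | ⟦b-power⟧ (suc K) r n = refl

  coefficient : Combination → ℕ → ℕ
  coefficient []             m = 0
  coefficient ((c , i) ∷ xs) m = pointMass i c m + coefficient xs m

  ⟦⟧-expansion : ∀ xs n → ⟦ xs ⟧ n ≡ sumℕ n (λ m → coefficient xs m * b m n)
  ⟦⟧-expansion []             n = sym (sumℕ-vanishes n _ (λ _ _ → refl))
  ⟦⟧-expansion ((c , i) ∷ xs) n = begin
    c * b i n + ⟦ xs ⟧ n
      ≡⟨ cong₂ _+_ single (⟦⟧-expansion xs n) ⟩
    sumℕ n (λ m → pointMass i c m * b m n) + sumℕ n (λ m → coefficient xs m * b m n)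
      ≡⟨ sumℕ-distrib-+ n _ _ ⟨
    sumℕ n (λ m → pointMass i c m * b m n + coefficient xs m * b m n)
      ≡⟨ sumℕ-cong n (λ m → *-distribʳ-+ (b m n) (pointMass i c m) (coefficient xs m)) ⟨
    sumℕ n (λ m → (pointMass i c m + coefficient xs m) * b m n) ∎
    where
    single : c * b i n ≡ sumℕ n (λ m → pointMass i c m * b m n)
    single with i ≤? n
    ... | yes i≤n = sym (sumℕ-pointMass n i c (λ m → b m n) i≤n)
    ... | no  i≰n rewrite b-vanishes (≰⇒> i≰n) = trans (*-zeroʳ c) (sym (sumℕ-vanishes n _
            (λ m m≤n → cong (_* b m n) (pointMass-off c (>⇒≢ (≤-<-trans m≤n (≰⇒> i≰n)))))))

  powerSum-expansion : ∀ r {K n} → n ≤ K →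
    sumℕ n (λ k → b k n ^ suc r) ≡ sumℕ n (λ m → coefficient (powerSum K r) m * b m n)
  powerSum-expansion r {K} {n} n≤K = begin
    sumℕ n (λ k → b k n ^ suc r)
      ≡⟨ sumℕ-extend n K _ n≤K (λ k n<k → cong (_^ suc r) (b-vanishes n<k)) ⟩
    sumℕ K (λ k → b k n ^ suc r)
      ≡⟨ ⟦powerSum⟧ K r n ⟨
    ⟦ powerSum K r ⟧ n
      ≡⟨ ⟦⟧-expansion (powerSum K r) n ⟩
    sumℕ n (λ m → coefficient (powerSum K r) m * b m n) ∎

fromℚᵘ-homo-+ : ∀ p q → fromℚᵘ (p ℚᵘ.+ q) ≡ fromℚᵘ p ℚ.+ fromℚᵘ q
fromℚᵘ-homo-+ p q = ℚ.toℚᵘ-injective (ℚᵘ.≃-trans (ℚ.toℚᵘ-fromℚᵘ (p ℚᵘ.+ q)) (ℚᵘ.≃-trans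
  (ℚᵘ.+-cong (ℚᵘ.≃-sym (ℚ.toℚᵘ-fromℚᵘ p)) (ℚᵘ.≃-sym (ℚ.toℚᵘ-fromℚᵘ q)))
  (ℚᵘ.≃-sym (ℚ.toℚᵘ-homo-+ (fromℚᵘ p) (fromℚᵘ q)))))

fromℚᵘ-homo-* : ∀ p q → fromℚᵘ (p ℚᵘ.* q) ≡ fromℚᵘ p ℚ.* fromℚᵘ q
fromℚᵘ-homo-* p q = ℚ.toℚᵘ-injective (ℚᵘ.≃-trans (ℚ.toℚᵘ-fromℚᵘ (p ℚᵘ.* q)) (ℚᵘ.≃-trans
  (ℚᵘ.*-cong (ℚᵘ.≃-sym (ℚ.toℚᵘ-fromℚᵘ p)) (ℚᵘ.≃-sym (ℚ.toℚᵘ-fromℚᵘ q)))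
  (ℚᵘ.≃-sym (ℚ.toℚᵘ-homo-* (fromℚᵘ p) (fromℚᵘ q)))))

ℕ→ℚ-homo-+ : ∀ m n → ℕ→ℚ (m + n) ≡ ℕ→ℚ m ℚ.+ ℕ→ℚ n
ℕ→ℚ-homo-+ m n = trans (ℚ.fromℚᵘ-cong {ℚᵘ.mkℚᵘ (ℤ.+ (m + n)) 0} {ℚᵘ.mkℚᵘ (ℤ.+ m) 0 ℚᵘ.+ ℚᵘ.mkℚᵘ (ℤ.+ n) 0}
                         (ℚᵘ.*≡* (trans (cong (ℤ._* ℤ.+ 1) (ℤ.pos-+ m n)) (unit-denominators (ℤ.+ m) (ℤ.+ n)))))
                       (fromℚᵘ-homo-+ (ℚᵘ.mkℚᵘ (ℤ.+ m) 0) (ℚᵘ.mkℚᵘ (ℤ.+ n) 0))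
  where
  unit-denominators : ∀ x y → (x ℤ.+ y) ℤ.* ℤ.+ 1 ≡ (x ℤ.* ℤ.+ 1 ℤ.+ y ℤ.* ℤ.+ 1) ℤ.* ℤ.+ 1
  unit-denominators = ℤ.solve-∀

ℕ→ℚ-homo-* : ∀ m n → ℕ→ℚ (m * n) ≡ ℕ→ℚ m ℚ.* ℕ→ℚ n
ℕ→ℚ-homo-* m n = trans (ℚ.fromℚᵘ-cong {ℚᵘ.mkℚᵘ (ℤ.+ (m * n)) 0} {ℚᵘ.mkℚᵘ (ℤ.+ m) 0 ℚᵘ.* ℚᵘ.mkℚᵘ (ℤ.+ n) 0}
                         (ℚᵘ.*≡* (cong (ℤ._* ℤ.+ 1) (ℤ.pos-* m n))))
                       (fromℚᵘ-homo-* (ℚᵘ.mkℚᵘ (ℤ.+ m) 0) (ℚᵘ.mkℚᵘ (ℤ.+ n) 0))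

ℕ→ℚ-sumℕ : ∀ n (f : ℕ → ℕ) → ℕ→ℚ (sumℕ n f) ≡ sumℚ n (λ m → ℕ→ℚ (f m))
ℕ→ℚ-sumℕ zero    f = refl
ℕ→ℚ-sumℕ (suc n) f =
  trans (ℕ→ℚ-homo-+ (sumℕ n f) (f (suc n))) (cong (ℚ._+ ℕ→ℚ (f (suc n))) (ℕ→ℚ-sumℕ n f))

sumℚ-cong : ∀ n {f g : ℕ → ℚ} → (∀ m → m ≤ n → f m ≡ g m) → sumℚ n f ≡ sumℚ n g
sumℚ-cong zero    f≗g = f≗g 0 z≤n
sumℚ-cong (suc n) f≗g =
  cong₂ ℚ._+_ (sumℚ-cong n (λ m m≤n → f≗g m (m≤n⇒m≤1+n m≤n))) (f≗g (suc n) ≤-refl)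

sumℚ-cancel-init : ∀ n (f g : ℕ → ℚ) →
  sumℚ n f ≡ sumℚ n g → (∀ m → m < n → f m ≡ g m) → f n ≡ g n
sumℚ-cancel-init zero    f g eq _   = eq
sumℚ-cancel-init (suc n) f g eq f≗g = ∙-cancelˡ (sumℚ n f) (f (suc n)) (g (suc n))
  (trans eq (cong (ℚ._+ g (suc n)) (sumℚ-cong n (λ m m≤n → sym (f≗g m (s≤s m≤n))))))

ℕ→ℚ-*-cancelˡ : ∀ {m} → 0 < m → ∀ p q → ℕ→ℚ m ℚ.* p ≡ ℕ→ℚ m ℚ.* q → p ≡ q
ℕ→ℚ-*-cancelˡ {suc m} _ p q eq =
  ℚ.≤-antisym (ℚ.*-cancelˡ-≤-pos (ℕ→ℚ (suc m)) (ℚ.≤-reflexive eq))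
              (ℚ.*-cancelˡ-≤-pos (ℕ→ℚ (suc m)) (ℚ.≤-reflexive (sym eq)))
  -- ℕ→ℚ (suc m) unfolds to normalize (suc m) 1
  where instance _ = ℚ.normalize-pos (suc m) 1

triangular-unique : (w : ℕ → ℕ → ℕ) → (∀ n → 0 < w n n) → (u v : ℕ → ℚ) → ∀ K →
  (∀ n → n ≤ K → sumℚ n (λ m → ℕ→ℚ (w m n) ℚ.* u m) ≡ sumℚ n (λ m → ℕ→ℚ (w m n) ℚ.* v m)) →
  ∀ m → m ≤ K → u m ≡ v m
triangular-unique w 0<w[n,n] u v K eqs = <-rec (λ m → m ≤ K → u m ≡ v m) step
  where
  step : ∀ m → (∀ {j} → j < m → j ≤ K → u j ≡ v j) → m ≤ K → u m ≡ v m
  step m ih m≤K = ℕ→ℚ-*-cancelˡ (0<w[n,n] m) (u m) (v m)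
    (sumℚ-cancel-init m _ _ (eqs m m≤K)
      (λ j j<m → cong (ℕ→ℚ (w j m) ℚ.*_) (ih j<m (≤-trans (<⇒≤ j<m) m≤K))))

open Linearisation B B-vanishes A B-product using (coefficient; powerSum; powerSum-expansion)

lhs-expansion : ∀ r {K n} → n ≤ K →
  lhs (suc r) n ≡ sumℕ n (λ m → coefficient (powerSum K r) m * B m n)
lhs-expansion r {K} {n} n≤K =
  trans (sumℕ-cong n (λ k → sym (*-^-distrib (n C k) ((n + k) C k) (suc r)))) (powerSum-expansion r n≤K)

mainTheorem1 : (r : ℕ) → r ≥ 1 → (c : ℕ → ℚ) → Defining r c →
    (k : ℕ) → ∃ λ (z : ℤ) → c k ≡ ℤ→ℚ z
mainTheorem1 (suc r) _ c defining k =
  ℤ.+ D k , triangular-unique B 0<B[n,n] c (ℕ→ℚ ∘ D) k same-sums k ≤-refl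
  where
  D : ℕ → ℕ
  D = coefficient (powerSum k r)
  same-sums : ∀ n → n ≤ k →
    sumℚ n (λ m → ℕ→ℚ (B m n) ℚ.* c m) ≡ sumℚ n (λ m → ℕ→ℚ (B m n) ℚ.* ℕ→ℚ (D m))
  same-sums n n≤k = begin
    sumℚ n (λ m → ℕ→ℚ (B m n) ℚ.* c m)         ≡⟨ defining n ⟨
    ℕ→ℚ (lhs (suc r) n)                         ≡⟨ cong ℕ→ℚ (lhs-expansion r n≤k) ⟩
    ℕ→ℚ (sumℕ n (λ m → D m * B m n))            ≡⟨ ℕ→ℚ-sumℕ n (λ m → D m * B m n) ⟩
    sumℚ n (λ m → ℕ→ℚ (D m * B m n))            ≡⟨ sumℚ-cong n (λ m _ → trans (cong ℕ→ℚ (*-comm (D m) (B m n)))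
                                                                              (ℕ→ℚ-homo-* (B m n) (D m))) ⟩
    sumℚ n (λ m → ℕ→ℚ (B m n) ℚ.* ℕ→ℚ (D m))  ∎
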